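{- Let $f$ be a partial 2-max function on $\{1,\dots,n\}$ with parameter $A>0$. Then the number of $f$-derangements is even.
   Context: A partial 2-max function is a function $f$ from a subset $S\subseteq\{1,\dots,n\}$ to $\{1,\dots,n\}$ such that every value has at most two preimages. Its parameter $A$ is the number of elements $i\in S$ whose image $f(i)$ has exactly two preimages under $f$. An $f$-derangement is a permutation $g$ of $\{1,\dots,n\}$ with $g(i)\neq f(i)$ for every $i\in S$. -}

module Defs where

open import Data.Nat using (ℕ; zero; suc; _≤_)
open import Data.Fin using (Fin; zero; suc)
open import Data.Fin.Properties using () renaming (_≟_ to _≟ᶠ_)
open import Data.Maybe using (Maybe; just; nothing)
open import Data.List using (List; []; _∷_; map; concatMap; allFin; length; filter)
open import Data.List.Relation.Unary.All using (All)
open import Data.List.Relation.Unary.All using () renaming (all? to allL?)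
open import Data.Product using (_×_; _,_)
open import Relation.Nullary using (¬_; Dec; yes; no)
open import Relation.Nullary.Decidable using (_×-dec_; ¬?)
open import Relation.Binary.PropositionalEquality using (_≡_; _≢_; refl)
open import Relation.Unary using (Decidable)

-- A partial function from a subset S of {1..n} (encoded as Fin n) to Fin n:
-- f i ≡ nothing means i ∉ S, f i ≡ just j means i ∈ S and f(i) = j.
PartialFun : ℕ → Set
PartialFun n = Fin n → Maybe (Fin n)

mapsTo? : ∀ {n} (f : PartialFun n) (v : Fin n) (i : Fin n) → Dec (f i ≡ just v)
mapsTo? f v i with f i
... | nothing = no (λ ())
... | just w with w ≟ᶠ v
...   | yes refl = yes refl
...   | no w≢v = no (λ { refl → w≢v refl })

preimageCount : ∀ {n} → PartialFun n → Fin n → ℕ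
preimageCount {n} f v = length (filter (mapsTo? f v) (allFin n))

Is2Max : ∀ {n} → PartialFun n → Set
Is2Max {n} f = ∀ (v : Fin n) → preimageCount f v ≤ 2

HasDoubleImage : ∀ {n} → PartialFun n → Fin n → Set
HasDoubleImage f i with f i
... | nothing = Data.Empty.⊥ where import Data.Empty
... | just v = preimageCount f v ≡ 2

hasDoubleImage? : ∀ {n} (f : PartialFun n) → Decidable (HasDoubleImage f)
hasDoubleImage? f i with f i
... | nothing = no (λ ())
... | just v = preimageCount f v Data.Nat.≟ 2 where import Data.Nat

paramA : ∀ {n} → PartialFun n → ℕ
paramA {n} f = length (filter (hasDoubleImage? f) (allFin n))

allFuns : (m n : ℕ) → List (Fin m → Fin n)
allFuns zero    n = (λ ()) ∷ []
allFuns (suc m) n =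
  concatMap (λ g → map (λ j → λ { zero → j ; (suc i) → g i }) (allFin n)) (allFuns m n)

-- injectivity (equivalently bijectivity, for maps Fin n → Fin n), decidable
Inj : ∀ {n} → (Fin n → Fin n) → Set
Inj {n} g = All (λ i → All (λ j → g i ≡ g j → i ≡ j) (allFin n)) (allFin n)

inj? : ∀ {n} → Decidable (Inj {n})
inj? {n} g = allL? (λ i → allL? (λ j → imp i j) (allFin n)) (allFin n)
  where
  imp : ∀ i j → Dec (g i ≡ g j → i ≡ j)
  imp i j with i ≟ᶠ j
  ... | yes e = yes (λ _ → e)
  ... | no ne with g i ≟ᶠ g j
  ...   | yes ge = no (λ h → ne (h ge))
  ...   | no nge = yes (λ ge → Data.Empty.⊥-elim (nge ge)) where import Data.Empty

Avoids : ∀ {n} → PartialFun n → (Fin n → Fin n) → Set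
Avoids {n} f g = All (λ i → ¬ (f i ≡ just (g i))) (allFin n)

avoids? : ∀ {n} (f : PartialFun n) → Decidable (Avoids f)
avoids? {n} f g = allL? (λ i → ¬? (mapsTo? f (g i) i)) (allFin n)

IsFDerangement : ∀ {n} → PartialFun n → (Fin n → Fin n) → Set
IsFDerangement f g = Inj g × Avoids f g

isFDerangement? : ∀ {n} (f : PartialFun n) → Decidable (IsFDerangement f)
isFDerangement? f g = inj? g ×-dec avoids? f g

-- number of f-derangements (each map Fin n → Fin n occurs exactly once in allFuns)
numFDerangements : ∀ {n} → PartialFun n → ℕ
numFDerangements {n} f = length (filter (isFDerangement? f) (allFuns n n))

-- If A > 0 there are a ≠ b in S with f(a) = f(b). Precomposing with the
-- transposition (a b) maps f-derangements to f-derangements, is an involution,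
-- and fixes no f-derangement g (that would force g(a) = g(b)). So the
-- f-derangements split into pairs {g, g ∘ (a b)}.
module Submission where

open import Defs
open import Data.Nat using (ℕ; zero; suc; _<_; _≤_; _%_; s≤s)
open import Data.Nat.Properties using (≤-refl; ≤-trans; n≤1+n)
open import Data.Nat.Divisibility using (_∣_; ∣-refl; _∣0; ∣m∣n⇒∣m+n; n∣m⇒m%n≡0)
open import Data.Fin using (Fin; _≟_)
open import Data.Fin.Permutation.Components using (transpose)
open import Data.Vec using (Vec; []; _∷_; lookup; tabulate)
open import Data.Vec.Properties using (≡-dec; lookup∘tabulate; tabulate∘lookup; tabulate-cong; ∷-injectiveˡ; ∷-injectiveʳ)
open import Data.List using (List; []; _∷_; map; concatMap; allFin; length; filter)
open import Data.List.Properties using (filter-accept; filter-reject; filter-all; map-concatMap; concatMap-cong; concatMap-map; map-∘)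
open import Data.List.Membership.Propositional using (_∈_)
open import Data.List.Membership.Propositional.Properties using (∈-filter⁺; ∈-filter⁻; ∈-allFin; ∈-map⁺; ∈-map⁻; ∈-concat⁺′)
open import Data.List.Relation.Unary.Any using (here; there)
open import Data.List.Relation.Unary.All as All using ([]; _∷_)
open import Data.List.Relation.Unary.All.Properties as All using ()
open import Data.List.Relation.Unary.AllPairs as AllPairs using ([]; _∷_)
open import Data.List.Relation.Unary.AllPairs.Properties as AllPairs using ()
open import Data.List.Relation.Unary.Unique.Propositional using (Unique)
open import Data.List.Relation.Unary.Unique.Propositional.Properties as Unique using ()
open import Data.Maybe using (just)
open import Data.Product using (∃; ∃₂; _×_; _,_; proj₁; proj₂)
open import Data.Empty using (⊥; ⊥-elim)
open import Function using (_∘_)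
open import Function.Definitions using (Injective)
open import Relation.Binary.Definitions using (DecidableEquality)
open import Relation.Binary.PropositionalEquality using (_≡_; _≢_; _≗_; refl; sym; trans; cong; subst; module ≡-Reasoning)
open import Relation.Nullary using (Dec; yes; no)
open import Relation.Nullary.Decidable using (¬?; dec-true; dec-false)
open import Relation.Unary using (Decidable; _≐_)

module FixedPointFreeInvolution {A : Set} (_≟ᴬ_ : DecidableEquality A)
  (σ : A → A) (σ-involutive : ∀ x → σ (σ x) ≡ x) where

  σ-injective : Injective _≡_ _≡_ σ
  σ-injective {x} {y} σx≡σy = trans (sym (σ-involutive x)) (trans (cong σ σx≡σy) (σ-involutive y))

  ClosedFixedPointFree : List A → Set
  ClosedFixedPointFree xs = ∀ {x} → x ∈ xs → σ x ∈ xs × σ x ≢ x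

  ≢? : (y : A) → Decidable (_≢ y)
  ≢? y x = ¬? (x ≟ᴬ y)

  erase : A → List A → List A
  erase y = filter (≢? y)

  length-erase : ∀ {y xs} → Unique xs → y ∈ xs → length xs ≡ suc (length (erase y xs))
  length-erase {y} {x ∷ xs} (x∉xs ∷ _) (here refl)
    rewrite filter-reject (≢? y) {y} {xs} (λ y≢y → y≢y refl)
          | filter-all (≢? y) {xs} (All.map (λ x≢z z≡x → x≢z (sym z≡x)) x∉xs) = refl
  length-erase {y} {x ∷ xs} (x∉xs ∷ xs-unique) (there y∈xs)
    rewrite filter-accept (≢? y) {x} {xs} (All.lookup x∉xs y∈xs) =
      cong suc (length-erase xs-unique y∈xs)

  erase-partner-closed : ∀ {x xs} → Unique (x ∷ xs) → ClosedFixedPointFree (x ∷ xs) →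
                         ClosedFixedPointFree (erase (σ x) xs)
  erase-partner-closed {x} {xs} (x∉xs ∷ _) closed {z} z∈erased
    with z∈xs , z≢σx ← ∈-filter⁻ (≢? (σ x)) z∈erased
    with closed (there z∈xs)
  ... | here σz≡x , _ = ⊥-elim (z≢σx (σ-injective (trans σz≡x (sym (σ-involutive x)))))
  ... | there σz∈xs , σz≢z =
    ∈-filter⁺ (≢? (σ x)) σz∈xs (λ σz≡σx → All.lookup x∉xs z∈xs (sym (σ-injective σz≡σx))) ,
    σz≢z

  partner-∈-tail : ∀ {x xs} → ClosedFixedPointFree (x ∷ xs) → σ x ∈ xs
  partner-∈-tail closed with closed (here refl)
  ... | here σx≡x , σx≢x = ⊥-elim (σx≢x σx≡x)
  ... | there σx∈xs , _ = σx∈xs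

  closedFixedPointFree⇒even : ∀ {xs} → Unique xs → ClosedFixedPointFree xs → 2 ∣ length xs
  closedFixedPointFree⇒even {xs} = go (length xs) xs ≤-refl
    where
    go : ∀ N xs → length xs ≤ N → Unique xs → ClosedFixedPointFree xs → 2 ∣ length xs
    go _ [] _ _ _ = 2 ∣0
    go (suc N) (x ∷ xs) (s≤s |xs|≤N) unique@(_ ∷ xs-unique) closed =
      subst (λ m → 2 ∣ suc m) (sym |xs|≡1+|rest|)
        (∣m∣n⇒∣m+n ∣-refl
          (go N (erase (σ x) xs)
             (≤-trans (n≤1+n _) (subst (_≤ N) |xs|≡1+|rest| |xs|≤N))
             (Unique.filter⁺ (≢? (σ x)) xs-unique)
             (erase-partner-closed unique closed)))
      where
      |xs|≡1+|rest| : length xs ≡ suc (length (erase (σ x) xs))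
      |xs|≡1+|rest| = length-erase xs-unique (partner-∈-tail closed)

length-filter-map : ∀ {A B : Set} {P : A → Set} {Q : B → Set} (P? : Decidable P) (Q? : Decidable Q)
                    (h : A → B) → P ≐ (Q ∘ h) →
                    ∀ xs → length (filter P? xs) ≡ length (filter Q? (map h xs))
length-filter-map P? Q? h P≐Q∘h [] = refl
length-filter-map P? Q? h P≐Q∘h (x ∷ xs) with P? x | Q? (h x)
... | yes _  | yes _   = cong suc (length-filter-map P? Q? h P≐Q∘h xs)
... | yes px | no ¬qhx = ⊥-elim (¬qhx (proj₁ P≐Q∘h px))
... | no ¬px | yes qhx = ⊥-elim (¬px (proj₂ P≐Q∘h qhx))
... | no _   | no _    = length-filter-map P? Q? h P≐Q∘h xs

allVecs : (m n : ℕ) → List (Vec (Fin n) m)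
allVecs zero    n = [] ∷ []
allVecs (suc m) n = concatMap (λ v → map (_∷ v) (allFin n)) (allVecs m n)

map-tabulate-allFuns : ∀ m n → map tabulate (allFuns m n) ≡ allVecs m n
map-tabulate-allFuns zero    n = refl
map-tabulate-allFuns (suc m) n = begin
  map tabulate (allFuns (suc m) n)
    ≡⟨ map-concatMap tabulate _ (allFuns m n) ⟩
  concatMap (λ g → map tabulate (map _ (allFin n))) (allFuns m n)
    ≡⟨ concatMap-cong (λ _ → sym (map-∘ (allFin n))) (allFuns m n) ⟩
  concatMap (consAll ∘ tabulate) (allFuns m n)
    ≡⟨ concatMap-map consAll tabulate (allFuns m n) ⟨
  concatMap consAll (map tabulate (allFuns m n))
    ≡⟨ cong (concatMap consAll) (map-tabulate-allFuns m n) ⟩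
  allVecs (suc m) n
    ∎
  where
  open ≡-Reasoning
  consAll : Vec (Fin n) m → List (Vec (Fin n) (suc m))
  consAll v = map (_∷ v) (allFin n)

allVecs-unique : ∀ m n → Unique (allVecs m n)
allVecs-unique zero    n = [] ∷ []
allVecs-unique (suc m) n =
  Unique.concat⁺ (All.map⁺ (All.tabulate (λ _ → Unique.map⁺ ∷-injectiveˡ (Unique.allFin⁺ n))))
                 (AllPairs.map⁺ (AllPairs.map disjoint (allVecs-unique m n)))
  where
  disjoint : ∀ {v w} → v ≢ w → ∀ {u} → u ∈ map (_∷ v) (allFin n) × u ∈ map (_∷ w) (allFin n) → ⊥
  disjoint v≢w (u∈v-ext , u∈w-ext) with ∈-map⁻ (_∷ _) u∈v-ext | ∈-map⁻ (_∷ _) u∈w-ext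
  ... | _ , _ , refl | _ , _ , u≡j∷w = v≢w (∷-injectiveʳ u≡j∷w)

∈-allVecs : ∀ m n (v : Vec (Fin n) m) → v ∈ allVecs m n
∈-allVecs zero    n [] = here refl
∈-allVecs (suc m) n (j ∷ v) =
  ∈-concat⁺′ (∈-map⁺ (_∷ v) (∈-allFin j))
             (∈-map⁺ (λ w → map (_∷ w) (allFin n)) (∈-allVecs m n v))

module _ {n : ℕ} where

  Inj⇒Injective : {g : Fin n → Fin n} → Inj g → Injective _≡_ _≡_ g
  Inj⇒Injective inj {i} {j} = All.lookup (All.lookup inj (∈-allFin i)) (∈-allFin j)

  Injective⇒Inj : {g : Fin n → Fin n} → Injective _≡_ _≡_ g → Inj g
  Injective⇒Inj injective = All.tabulate (λ _ → All.tabulate (λ _ → injective))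

  Avoids⇒≢ : {f : PartialFun n} {g : Fin n → Fin n} → Avoids f g → ∀ i → f i ≢ just (g i)
  Avoids⇒≢ avoids i = All.lookup avoids (∈-allFin i)

  ≢⇒Avoids : {f : PartialFun n} {g : Fin n → Fin n} → (∀ i → f i ≢ just (g i)) → Avoids f g
  ≢⇒Avoids avoids = All.tabulate (λ {i} _ → avoids i)

  IsFDerangement-resp-≗ : (f : PartialFun n) {g h : Fin n → Fin n} → g ≗ h →
                          IsFDerangement f g → IsFDerangement f h
  IsFDerangement-resp-≗ f g≗h (inj , avoids) =
    All.map (λ {i} → All.map (λ {j} g-inj hi≡hj →
      g-inj (trans (g≗h i) (trans hi≡hj (sym (g≗h j)))))) inj ,
    All.map (λ {i} fi≢gi fi≡hi → fi≢gi (trans fi≡hi (cong just (sym (g≗h i))))) avoids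

  IsFDerangement-∘-symmetry : (f : PartialFun n) {π g : Fin n → Fin n} →
                              (∀ k → π (π k) ≡ k) → (∀ k → f (π k) ≡ f k) →
                              IsFDerangement f g → IsFDerangement f (g ∘ π)
  IsFDerangement-∘-symmetry f {π} {g} π-involutive f∘π≗f (inj , avoids) =
    Injective⇒Inj π-then-g-injective ,
    ≢⇒Avoids (λ k fk≡gπk → Avoids⇒≢ avoids (π k) (trans (f∘π≗f k) fk≡gπk))
    where
    π-then-g-injective : Injective _≡_ _≡_ (g ∘ π)
    π-then-g-injective {i} {j} gπi≡gπj =
      trans (sym (π-involutive i)) (trans (cong π (Inj⇒Injective inj gπi≡gπj)) (π-involutive j))

-- Maps Fin n → Fin n have no decidable equality, so the derangements are counted as vectors.
numFDerangements-vec : ∀ {n} (f : PartialFun n) →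
  numFDerangements f ≡ length (filter (isFDerangement? f ∘ lookup) (allVecs n n))
numFDerangements-vec {n} f = trans
  (length-filter-map (isFDerangement? f) (isFDerangement? f ∘ lookup) tabulate
     ((λ {g} → IsFDerangement-resp-≗ f (λ i → sym (lookup∘tabulate g i))) ,
      (λ {g} → IsFDerangement-resp-≗ f (lookup∘tabulate g)))
     (allFuns n n))
  (cong (length ∘ filter (isFDerangement? f ∘ lookup)) (map-tabulate-allFuns n n))

numFDerangements-even : ∀ {n} (f : PartialFun n) (π : Fin n → Fin n) →
  (∀ k → π (π k) ≡ k) → (∀ k → f (π k) ≡ f k) → ∀ {a} → π a ≢ a →
  2 ∣ numFDerangements f
numFDerangements-even {n} f π π-involutive f∘π≗f {a} πa≢a =
  subst (2 ∣_) (sym (numFDerangements-vec f))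
    (closedFixedPointFree⇒even (Unique.filter⁺ D? (allVecs-unique n n)) closed)
  where
  permute : Vec (Fin n) n → Vec (Fin n) n
  permute v = tabulate (lookup v ∘ π)

  permute-involutive : ∀ v → permute (permute v) ≡ v
  permute-involutive v = trans
    (tabulate-cong (λ k → trans (lookup∘tabulate _ (π k)) (cong (lookup v) (π-involutive k))))
    (tabulate∘lookup v)

  open FixedPointFreeInvolution (≡-dec _≟_) permute permute-involutive

  D? : Decidable (IsFDerangement f ∘ lookup)
  D? = isFDerangement? f ∘ lookup

  closed : ClosedFixedPointFree (filter D? (allVecs n n))
  closed {v} v∈ with _ , derangement@(inj , _) ← ∈-filter⁻ D? {v} {allVecs n n} v∈ =
    ∈-filter⁺ D? (∈-allVecs n n (permute v))
      (IsFDerangement-resp-≗ f (λ k → sym (lookup∘tabulate _ k))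
        (IsFDerangement-∘-symmetry f π-involutive f∘π≗f derangement)) ,
    λ permute-v≡v → πa≢a (Inj⇒Injective inj (begin
      lookup v (π a)           ≡⟨ lookup∘tabulate _ a ⟨
      lookup (permute v) a     ≡⟨ cong (λ w → lookup w a) permute-v≡v ⟩
      lookup v a               ∎))
    where open ≡-Reasoning

module _ {n : ℕ} (i j : Fin n) where

  transpose-matchˡ : transpose i j i ≡ j
  transpose-matchˡ rewrite dec-true (i ≟ i) refl = refl

  transpose-matchʳ : transpose i j j ≡ i
  transpose-matchʳ with j ≟ i
  ... | yes j≡i = j≡i
  ... | no _ rewrite dec-true (j ≟ j) refl = refl

  transpose-other : ∀ {k} → k ≢ i → k ≢ j → transpose i j k ≡ k
  transpose-other {k} k≢i k≢j rewrite dec-false (k ≟ i) k≢i | dec-false (k ≟ j) k≢j = refl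

  transpose-moves : i ≢ j → transpose i j i ≢ i
  transpose-moves i≢j j≡i = i≢j (sym (trans (sym transpose-matchˡ) j≡i))

  transpose-involutive : ∀ k → transpose i j (transpose i j k) ≡ k
  transpose-involutive k = by-cases (k ≟ i) (k ≟ j)
    where
    by-cases : Dec (k ≡ i) → Dec (k ≡ j) → transpose i j (transpose i j k) ≡ k
    by-cases (yes refl) _          = trans (cong (transpose i j) transpose-matchˡ) transpose-matchʳ
    by-cases (no _)     (yes refl) = trans (cong (transpose i j) transpose-matchʳ) transpose-matchˡ
    by-cases (no k≢i)   (no k≢j)   =
      trans (cong (transpose i j) (transpose-other k≢i k≢j)) (transpose-other k≢i k≢j)

  ∘-transpose-invariant : {B : Set} (f : Fin n → B) → f i ≡ f j → ∀ k → f (transpose i j k) ≡ f k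
  ∘-transpose-invariant f fi≡fj k = by-cases (k ≟ i) (k ≟ j)
    where
    by-cases : Dec (k ≡ i) → Dec (k ≡ j) → f (transpose i j k) ≡ f k
    by-cases (yes refl) _          = trans (cong f transpose-matchˡ) (sym fi≡fj)
    by-cases (no _)     (yes refl) = trans (cong f transpose-matchʳ) fi≡fj
    by-cases (no k≢i)   (no k≢j)   = cong f (transpose-other k≢i k≢j)

∈⇒other-∈-of-length-2 : ∀ {A : Set} {xs : List A} {x} → Unique xs → length xs ≡ 2 → x ∈ xs →
                         ∃ λ y → y ∈ xs × x ≢ y
∈⇒other-∈-of-length-2 {xs = x ∷ y ∷ []} ((x≢y ∷ []) ∷ _) refl (here refl) = y , there (here refl) , x≢y
∈⇒other-∈-of-length-2 {xs = x ∷ y ∷ []} ((x≢y ∷ []) ∷ _) refl (there (here refl)) = x , here refl , x≢y ∘ sym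

hasDoubleImage⇒collision : ∀ {n} (f : PartialFun n) {a} → HasDoubleImage f a →
                           ∃ λ b → a ≢ b × f a ≡ f b
hasDoubleImage⇒collision {n} f {a} double with f a in fa≡w
... | just w
  with b , b∈preimages , a≢b ← ∈⇒other-∈-of-length-2
         (Unique.filter⁺ (mapsTo? f w) (Unique.allFin⁺ n)) double
         (∈-filter⁺ (mapsTo? f w) (∈-allFin a) fa≡w)
  = b , a≢b , sym (proj₂ (∈-filter⁻ (mapsTo? f w) {b} {allFin n} b∈preimages))

paramA-pos⇒collision : ∀ {n} (f : PartialFun n) → 0 < paramA f → ∃₂ λ a b → a ≢ b × f a ≡ f b
paramA-pos⇒collision {n} f 0<A with filter (hasDoubleImage? f) (allFin n) in doubles | 0<A
... | a ∷ _ | _ = a , hasDoubleImage⇒collision f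
  (proj₂ (∈-filter⁻ (hasDoubleImage? f) {a} {allFin n} (subst (a ∈_) (sym doubles) (here refl))))

mainTheorem5 : (n : ℕ) (f : PartialFun n) → Is2Max f → 0 < paramA f →
    numFDerangements f % 2 ≡ 0
mainTheorem5 n f _ 0<A =
  let a , b , a≢b , fa≡fb = paramA-pos⇒collision f 0<A in
  n∣m⇒m%n≡0 _ 2
    (numFDerangements-even f (transpose a b) (transpose-involutive a b)
       (∘-transpose-invariant a b f fa≡fb) (transpose-moves a b a≢b))
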